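{- For any finite poset $\mathcal P$, $w^*(\mathcal P)\le|\mathcal P|^2/4+2$.
   Context: For integers $h\le n$, $\binom{[n]}{\le h}$ denotes the induced subposet of the hypercube $Q_n$ (subsets of $[n]=\{1,\dots,n\}$ ordered by inclusion) consisting of all sets of size at most $h$. A poset contains an induced copy of $\mathcal P$ if it has a subset which, with the induced order, is isomorphic to $\mathcal P$. The cube-height $h^*(\mathcal P)$ is the minimum $h\in\mathbb N$ for which there exists $n\in\mathbb N$ such that $\binom{[n]}{\le h}$ contains an induced copy of $\mathcal P$. The cube-width $w^*(\mathcal P)$ is the minimum $w\in\mathbb N$ such that $\binom{[w]}{\le h^*(\mathcal P)}$ contains an induced copy of $\mathcal P$. -}

module Defs where

open import Level using (0ℓ)
open import Data.Nat using (ℕ; _≤_; _<_)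
open import Data.Fin using (Fin)
open import Data.Fin.Subset using (Subset; _⊆_; ∣_∣)
open import Data.Product using (Σ; ∃; _×_)
open import Function.Definitions using (Injective)
open import Relation.Binary.Structures using (IsPartialOrder)
open import Relation.Binary.PropositionalEquality using (_≡_)
open import Relation.Nullary using (¬_)

record FinPoset : Set₁ where
  field
    size   : ℕ
    _≼_    : Fin size → Fin size → Set
    isPartialOrder : IsPartialOrder _≡_ _≼_

open FinPoset public

-- An induced copy of P inside (binom [n] ≤h): an injective map into
-- subsets of [n] of size ≤ h which preserves and reflects the order.
record InducedCopy (P : FinPoset) (n h : ℕ) : Set where
  field
    f        : Fin (size P) → Subset n
    small    : ∀ x → ∣ f x ∣ ≤ h
    injective : Injective _≡_ _≡_ f
    preserve : ∀ x y → _≼_ P x y → f x ⊆ f y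
    reflect  : ∀ x y → f x ⊆ f y → _≼_ P x y

IsCubeHeight : FinPoset → ℕ → Set
IsCubeHeight P h =
  (∃ λ n → InducedCopy P n h) × (∀ h' → h' < h → ¬ (∃ λ n → InducedCopy P n h'))

-- w is the cube-width of P: minimum w such that binom [w] ≤h*(P) contains P.
IsCubeWidth : FinPoset → ℕ → Set
IsCubeWidth P w = ∃ λ h → IsCubeHeight P h ×
  InducedCopy P w h × (∀ w' → w' < w → ¬ InducedCopy P w' h)

-- Let f be an induced copy of P among the sets of size at most h.  If every principal
-- down-set ↓x of P has at most h elements, then x ↦ ↓x is an induced copy with ground
-- set P itself.  Otherwise pick x₀ with |↓x₀| > h.  Each f(x) lies in
-- T = f(x₀) ∪ ⋃_{z ≰ x₀} f(z), because f(x) ⊆ f(x₀) whenever x ≤ x₀, so restricting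
-- every f(x) to T gives an induced copy with ground set T.  With a = #{z : z ≰ x₀} we
-- have |T| ≤ (a + 1) h and a + 1 + h ≤ |P|, hence 4|T| ≤ (a + 1 + h)² ≤ |P|² by AM–GM.
module Submission where

open import Defs
open import Data.Nat using (ℕ; _≤_; _*_; _+_)
open import Data.Nat using (zero; suc; _<_; _∸_; z≤n; s≤s)
open import Data.Nat.Properties
open import Data.Nat.Tactic.RingSolver using (solve-∀)
open import Data.Fin using (Fin; zero; suc)
open import Data.Fin.Properties using (all?; ¬∀⟶∃¬)
open import Data.Fin.Subset using (Subset; inside; outside; _⊆_; _∈_; ∣_∣; _∪_; ⊥; ∁)
open import Data.Fin.Subset.Properties
  using (_⊆?_; _∈?_; drop-∷-⊆; out⊆; in⊆in; ⊆-reflexive; ⊆-trans; p⊆p∪q; q⊆p∪q;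
         ∣p∣≤∣x∷p∣; ∣⊥∣≡0; ∣p∣≤n; ∣∁p∣≡n∸∣p∣; x∉p⇒x∈∁p)
open import Data.Vec using ([]; _∷_; here; there)
open import Data.Sum using (inj₁; inj₂)
open import Data.Product using (∃; _×_; _,_)
open import Function using (_∘_)
open import Relation.Binary.PropositionalEquality using (_≡_; sym; cong; subst)
open import Relation.Binary.Structures using (IsPartialOrder)
open import Relation.Nullary using (yes; no; does; contradiction)
open import Relation.Nullary.Decidable using (from-yes)
open import Relation.Unary using (Pred; Decidable)

[m+[m+d]]*[m+[m+d]]≡4*[m*[m+d]]+d*d : ∀ m d →
  (m + (m + d)) * (m + (m + d)) ≡ 4 * (m * (m + d)) + d * d
[m+[m+d]]*[m+[m+d]]≡4*[m*[m+d]]+d*d = solve-∀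

m≤n⇒4*[m*n]≤[m+n]*[m+n] : ∀ {m n} → m ≤ n → 4 * (m * n) ≤ (m + n) * (m + n)
m≤n⇒4*[m*n]≤[m+n]*[m+n] {m} {n} m≤n =
  subst (λ k → 4 * (m * k) ≤ (m + k) * (m + k)) (m+[n∸m]≡n m≤n)
    (subst (4 * (m * (m + d)) ≤_) (sym ([m+[m+d]]*[m+[m+d]]≡4*[m*[m+d]]+d*d m d))
      (m≤m+n _ (d * d)))
  where d = n ∸ m

4*[m*n]≤[m+n]*[m+n] : ∀ m n → 4 * (m * n) ≤ (m + n) * (m + n)
4*[m*n]≤[m+n]*[m+n] m n with ≤-total m n
... | inj₁ m≤n = m≤n⇒4*[m*n]≤[m+n]*[m+n] m≤n
... | inj₂ n≤m rewrite *-comm m n | +-comm m n = m≤n⇒4*[m*n]≤[m+n]*[m+n] n≤m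

4*n≤n*n+8 : ∀ n → 4 * n ≤ n * n + 8
4*n≤n*n+8 0 = z≤n
4*n≤n*n+8 1 = from-yes (4 ≤? 9)
4*n≤n*n+8 2 = from-yes (8 ≤? 12)
4*n≤n*n+8 3 = from-yes (12 ≤? 17)
4*n≤n*n+8 n@(suc (suc (suc (suc k)))) =
  ≤-trans (*-monoˡ-≤ n (s≤s (s≤s (s≤s (s≤s (z≤n {k})))))) (m≤m+n (n * n) 8)

subsetOf : ∀ {m ℓ} {Q : Pred (Fin m) ℓ} → Decidable Q → Subset m
subsetOf {zero}  Q? = []
subsetOf {suc m} Q? = does (Q? zero) ∷ subsetOf (Q? ∘ suc)

∈-subsetOf⁺ : ∀ {m ℓ} {Q : Pred (Fin m) ℓ} (Q? : Decidable Q) {z} → Q z → z ∈ subsetOf Q?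
∈-subsetOf⁺ Q? {zero} q with Q? zero
... | yes _  = here
... | no ¬q = contradiction q ¬q
∈-subsetOf⁺ Q? {suc z} q = there (∈-subsetOf⁺ (Q? ∘ suc) q)

∈-subsetOf⁻ : ∀ {m ℓ} {Q : Pred (Fin m) ℓ} (Q? : Decidable Q) {z} → z ∈ subsetOf Q? → Q z
∈-subsetOf⁻ Q? {zero} z∈ with Q? zero
∈-subsetOf⁻ Q? {zero} z∈ | yes q = q
∈-subsetOf⁻ Q? {zero} () | no _
∈-subsetOf⁻ Q? {suc z} (there z∈) = ∈-subsetOf⁻ (Q? ∘ suc) z∈

∣p∪q∣≤∣p∣+∣q∣ : ∀ {n} (p q : Subset n) → ∣ p ∪ q ∣ ≤ ∣ p ∣ + ∣ q ∣
∣p∪q∣≤∣p∣+∣q∣ [] [] = z≤n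
∣p∪q∣≤∣p∣+∣q∣ (outside ∷ p) (outside ∷ q) = ∣p∪q∣≤∣p∣+∣q∣ p q
∣p∪q∣≤∣p∣+∣q∣ (outside ∷ p) (inside ∷ q) =
  subst (suc ∣ p ∪ q ∣ ≤_) (sym (+-suc ∣ p ∣ ∣ q ∣)) (s≤s (∣p∪q∣≤∣p∣+∣q∣ p q))
∣p∪q∣≤∣p∣+∣q∣ (inside ∷ p) (outside ∷ q) = s≤s (∣p∪q∣≤∣p∣+∣q∣ p q)
∣p∪q∣≤∣p∣+∣q∣ (inside ∷ p) (inside ∷ q) =
  s≤s (≤-trans (∣p∪q∣≤∣p∣+∣q∣ p q) (+-monoʳ-≤ ∣ p ∣ (n≤1+n ∣ q ∣)))

infix 9 ⋃[_]_

⋃[_]_ : ∀ {m n} → Subset m → (Fin m → Subset n) → Subset n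
⋃[ [] ] F = ⊥
⋃[ outside ∷ S ] F = ⋃[ S ] (F ∘ suc)
⋃[ inside ∷ S ] F = F zero ∪ ⋃[ S ] (F ∘ suc)

∣⋃[S]F∣≤∣S∣*h : ∀ {m n h} (S : Subset m) (F : Fin m → Subset n) →
  (∀ z → ∣ F z ∣ ≤ h) → ∣ ⋃[ S ] F ∣ ≤ ∣ S ∣ * h
∣⋃[S]F∣≤∣S∣*h {n = n} [] F _ = ≤-reflexive (∣⊥∣≡0 n)
∣⋃[S]F∣≤∣S∣*h (outside ∷ S) F small = ∣⋃[S]F∣≤∣S∣*h S (F ∘ suc) (small ∘ suc)
∣⋃[S]F∣≤∣S∣*h (inside ∷ S) F small = ≤-trans (∣p∪q∣≤∣p∣+∣q∣ (F zero) (⋃[ S ] (F ∘ suc)))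
  (+-mono-≤ (small zero) (∣⋃[S]F∣≤∣S∣*h S (F ∘ suc) (small ∘ suc)))

z∈S⇒Fz⊆⋃[S]F : ∀ {m n} {S : Subset m} (F : Fin m → Subset n) {z} → z ∈ S → F z ⊆ ⋃[ S ] F
z∈S⇒Fz⊆⋃[S]F {S = inside ∷ S} F here = p⊆p∪q (⋃[ S ] (F ∘ suc))
z∈S⇒Fz⊆⋃[S]F {S = outside ∷ S} F (there z∈S) = z∈S⇒Fz⊆⋃[S]F (F ∘ suc) z∈S
z∈S⇒Fz⊆⋃[S]F {S = inside ∷ S} F (there z∈S) =
  ⊆-trans (z∈S⇒Fz⊆⋃[S]F (F ∘ suc) z∈S) (q⊆p∪q (F zero) (⋃[ S ] (F ∘ suc)))

restrict : ∀ {n} (T : Subset n) → Subset n → Subset ∣ T ∣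
restrict [] [] = []
restrict (outside ∷ T) (_ ∷ p) = restrict T p
restrict (inside ∷ T) (s ∷ p) = s ∷ restrict T p

∣restrict∣≤∣p∣ : ∀ {n} (T p : Subset n) → ∣ restrict T p ∣ ≤ ∣ p ∣
∣restrict∣≤∣p∣ [] [] = z≤n
∣restrict∣≤∣p∣ (outside ∷ T) (s ∷ p) = ≤-trans (∣restrict∣≤∣p∣ T p) (∣p∣≤∣x∷p∣ s p)
∣restrict∣≤∣p∣ (inside ∷ T) (outside ∷ p) = ∣restrict∣≤∣p∣ T p
∣restrict∣≤∣p∣ (inside ∷ T) (inside ∷ p) = s≤s (∣restrict∣≤∣p∣ T p)

restrict-mono : ∀ {n} (T : Subset n) {p q} → p ⊆ q → restrict T p ⊆ restrict T q
restrict-mono [] {[]} {[]} p⊆q = p⊆q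
restrict-mono (outside ∷ T) {_ ∷ p} {_ ∷ q} p⊆q = restrict-mono T (drop-∷-⊆ p⊆q)
restrict-mono (inside ∷ T) {outside ∷ p} {_ ∷ q} p⊆q = out⊆ (restrict-mono T (drop-∷-⊆ p⊆q))
restrict-mono (inside ∷ T) {inside ∷ p} {inside ∷ q} p⊆q = in⊆in (restrict-mono T (drop-∷-⊆ p⊆q))
restrict-mono (inside ∷ T) {inside ∷ p} {outside ∷ q} p⊆q = contradiction (p⊆q here) λ ()

restrict-reflects : ∀ {n} (T : Subset n) {p q} → p ⊆ T → restrict T p ⊆ restrict T q → p ⊆ q
restrict-reflects [] {[]} {[]} _ r = r
restrict-reflects (outside ∷ T) {outside ∷ p} {_ ∷ q} p⊆T r =
  out⊆ (restrict-reflects T (drop-∷-⊆ p⊆T) r)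
restrict-reflects (outside ∷ T) {inside ∷ p} p⊆T r = contradiction (p⊆T here) λ ()
restrict-reflects (inside ∷ T) {outside ∷ p} {_ ∷ q} p⊆T r =
  out⊆ (restrict-reflects T (drop-∷-⊆ p⊆T) (drop-∷-⊆ r))
restrict-reflects (inside ∷ T) {inside ∷ p} {inside ∷ q} p⊆T r =
  in⊆in (restrict-reflects T (drop-∷-⊆ p⊆T) (drop-∷-⊆ r))
restrict-reflects (inside ∷ T) {inside ∷ p} {outside ∷ q} p⊆T r = contradiction (r here) λ ()

inducedCopy : ∀ (P : FinPoset) {k h} (g : Fin (size P) → Subset k) → (∀ x → ∣ g x ∣ ≤ h) →
  (∀ x y → _≼_ P x y → g x ⊆ g y) → (∀ x y → g x ⊆ g y → _≼_ P x y) → InducedCopy P k h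
inducedCopy P g small preserve reflect = record
  { f = g
  ; small = small
  ; injective = λ {x} {y} gx≡gy →
      antisym (reflect x y (⊆-reflexive gx≡gy)) (reflect y x (⊆-reflexive (sym gx≡gy)))
  ; preserve = preserve
  ; reflect = reflect
  }
  where open IsPartialOrder (isPartialOrder P) using (antisym)

module _ {P : FinPoset} {n h : ℕ} (copy : InducedCopy P n h) where
  open InducedCopy copy
  open IsPartialOrder (isPartialOrder P) using () renaming (refl to ≼-refl; trans to ≼-trans)

  private
    m : ℕ
    m = size P

  -- The order of P need not be decidable; it is decided through f, which reflects it.
  downSet : Fin m → Subset m
  downSet x = subsetOf (λ z → f z ⊆? f x)

  ∈-downSet⁺ : ∀ {z x} → _≼_ P z x → z ∈ downSet x
  ∈-downSet⁺ {z} {x} z≼x = ∈-subsetOf⁺ (λ z → f z ⊆? f x) (preserve z x z≼x)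

  ∈-downSet⁻ : ∀ {z x} → z ∈ downSet x → _≼_ P z x
  ∈-downSet⁻ {z} {x} z∈ = reflect z x (∈-subsetOf⁻ (λ z → f z ⊆? f x) z∈)

  downSetCopy : (∀ x → ∣ downSet x ∣ ≤ h) → InducedCopy P m h
  downSetCopy small = inducedCopy P downSet small
    (λ x y x≼y z∈↓x → ∈-downSet⁺ (≼-trans (∈-downSet⁻ z∈↓x) x≼y))
    (λ x y ↓x⊆↓y → ∈-downSet⁻ (↓x⊆↓y (∈-downSet⁺ ≼-refl)))

  module _ (x₀ : Fin m) where
    support : Subset n
    support = f x₀ ∪ ⋃[ ∁ (downSet x₀) ] f

    f⊆support : ∀ x → f x ⊆ support
    f⊆support x with x ∈? downSet x₀
    ... | yes x∈↓x₀ = ⊆-trans (preserve x x₀ (∈-downSet⁻ x∈↓x₀)) (p⊆p∪q _)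
    ... | no x∉↓x₀ = ⊆-trans (z∈S⇒Fz⊆⋃[S]F f (x∉p⇒x∈∁p x∉↓x₀)) (q⊆p∪q (f x₀) _)

    supportCopy : InducedCopy P ∣ support ∣ h
    supportCopy = inducedCopy P (restrict support ∘ f)
      (λ x → ≤-trans (∣restrict∣≤∣p∣ support (f x)) (small x))
      (λ x y x≼y → restrict-mono support (preserve x y x≼y))
      (λ x y r → reflect x y (restrict-reflects support (f⊆support x) r))

    ∣support∣≤[1+a]*h : ∣ support ∣ ≤ suc ∣ ∁ (downSet x₀) ∣ * h
    ∣support∣≤[1+a]*h = ≤-trans (∣p∪q∣≤∣p∣+∣q∣ (f x₀) _)
      (+-mono-≤ (small x₀) (∣⋃[S]F∣≤∣S∣*h (∁ (downSet x₀)) f small))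

    1+a+h≤m : h < ∣ downSet x₀ ∣ → suc ∣ ∁ (downSet x₀) ∣ + h ≤ m
    1+a+h≤m h<d = begin
      suc a + h ≡⟨ sym (+-suc a h) ⟩
      a + suc h ≤⟨ +-monoʳ-≤ a h<d ⟩
      a + d     ≡⟨ cong (_+ d) (∣∁p∣≡n∸∣p∣ (downSet x₀)) ⟩
      m ∸ d + d ≡⟨ m∸n+n≡m (∣p∣≤n (downSet x₀)) ⟩
      m         ∎
      where
      open ≤-Reasoning
      a = ∣ ∁ (downSet x₀) ∣
      d = ∣ downSet x₀ ∣

    4*∣support∣≤m*m : h < ∣ downSet x₀ ∣ → 4 * ∣ support ∣ ≤ m * m
    4*∣support∣≤m*m h<d = begin
      4 * ∣ support ∣             ≤⟨ *-monoʳ-≤ 4 ∣support∣≤[1+a]*h ⟩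
      4 * (suc a * h)             ≤⟨ 4*[m*n]≤[m+n]*[m+n] (suc a) h ⟩
      (suc a + h) * (suc a + h)   ≤⟨ *-mono-≤ (1+a+h≤m h<d) (1+a+h≤m h<d) ⟩
      m * m                       ∎
      where
      open ≤-Reasoning
      a = ∣ ∁ (downSet x₀) ∣

  narrowCopy : ∃ λ w → InducedCopy P w h × 4 * w ≤ m * m + 8
  narrowCopy with all? (λ x → ∣ downSet x ∣ ≤? h)
  ... | yes small = m , downSetCopy small , 4*n≤n*n+8 m
  ... | no ¬small with ¬∀⟶∃¬ m (λ x → ∣ downSet x ∣ ≤ h) (λ x → ∣ downSet x ∣ ≤? h) ¬small
  ... | x₀ , large =
    ∣ support x₀ ∣ , supportCopy x₀ , ≤-trans (4*∣support∣≤m*m x₀ (≰⇒> large)) (m≤m+n (m * m) 8)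

lemma2p5 : (P : FinPoset) (w : ℕ) → IsCubeWidth P w →
    4 * w ≤ size P * size P + 8
lemma2p5 P w (h , _ , copy , minimal) with narrowCopy copy
... | w′ , copy′ , 4w′≤ = ≤-trans (*-monoʳ-≤ 4 (≮⇒≥ (λ w′<w → minimal w′ w′<w copy′))) 4w′≤
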